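{- Consider a skip graph with $n$ nodes over a fixed finite alphabet $\Sigma$ with $|\Sigma|\ge 2$. The search operation for a key $k$ started at any node $s$ uses an expected $O(\log n)$ messages and takes expected $O(\log n)$ time (as $n\to\infty$, with $|\Sigma|$ fixed).
   Context: Skip graph: a finite set of nodes with distinct keys from a totally ordered set; each node $x$ has a membership vector $m(x)\in\Sigma^\omega$ whose symbols are chosen independently and uniformly at random from $\Sigma$. For each finite word $w$, $S_w$ is the list of nodes $x$ whose membership vector has prefix $w$, sorted by key and doubly linked; $w\upharpoonright i$ is the length-$i$ prefix of $w$. For a node $x$ and level $\ell$, $xR_\ell$ and $xL_\ell$ denote the successor and predecessor of $x$ in $S_{m(x)\upharpoonright \ell}$ (or $\bot$ if none), and $x.\mathrm{maxLevel}$ is the least level $\ell$ at which $x$ is alone in $S_{m(x)\upharpoonright\ell}$. Nodes communicate by messages, each message taking at most one unit of time to deliver and local computation taking no time. Search for key $k$ from node $s$: the search message carries a current level, initially $s.\mathrm{maxLevel}$. A node $v$ receiving it does: if $v$'s key equals $k$, report $v$ as found; if $v$'s key is less than $k$, then while the level is $\ge 0$, if $vR_{\text{level}}$ exists and its key is $\le k$, forward the search (with the current level) to $vR_{\text{level}}$, otherwise decrease the level by one; symmetrically if $v$'s key exceeds $k$, using $vL_{\text{level}}$ and keys $\ge k$; if the level drops below $0$, report $v$ (the node with the nearest key on the approached side) as "not found". -}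

module Defs where

open import Data.Nat using (ℕ; zero; suc; _+_; _*_)
open import Data.Nat.Properties using (_<?_; _≤?_; _≟_)
open import Data.Fin as F using (Fin)
open import Data.Vec as V using (Vec)
open import Data.List as L using (List; []; _∷_)
open import Data.List.Properties using (≡-dec)
open import Data.Nat.ListAction using (sum)
open import Data.Bool.ListAction using (and)
open import Data.Maybe using (Maybe; just; nothing)
open import Data.Bool using (Bool; true; false; if_then_else_; _∧_; _∨_; not)
open import Relation.Nullary.Decidable using (⌊_⌋)

allVecs : ∀ {A : Set} (k : ℕ) → List A → List (Vec A k)
allVecs zero    xs = V.[] ∷ []
allVecs (suc k) xs = L.concatMap (λ x → L.map (x V.∷_) (allVecs k xs)) xs

-- Length-D prefixes of the membership vectors of n nodes over alphabet Fin σ.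
Membership : ℕ → ℕ → ℕ → Set
Membership σ D n = Vec (Vec (Fin σ) D) n

allMemberships : (σ D n : ℕ) → List (Membership σ D n)
allMemberships σ D n = allVecs n (allVecs D (L.allFin σ))

prefix : ∀ {σ D} → ℕ → Vec (Fin σ) D → List (Fin σ)
prefix ℓ w = L.take ℓ (V.toList w)

sameList : ∀ {σ D n} → Membership σ D n → ℕ → Fin n → Fin n → Bool
sameList m ℓ x y = ⌊ ≡-dec F._≟_ (prefix ℓ (V.lookup m x)) (prefix ℓ (V.lookup m y)) ⌋

selectBest : ∀ {n} → (Fin n → ℕ) → (Fin n → Bool) → (ℕ → ℕ → Bool) → Maybe (Fin n)
selectBest {n} key ok better = L.foldr step nothing (L.allFin n)
  where
  step : Fin n → Maybe (Fin n) → Maybe (Fin n)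
  step y nothing  = if ok y then just y else nothing
  step y (just z) = if ok y ∧ better (key y) (key z) then just y else just z

succR : ∀ {σ D n} → (Fin n → ℕ) → Membership σ D n → ℕ → Fin n → Maybe (Fin n)
succR key m ℓ x =
  selectBest key (λ y → sameList m ℓ x y ∧ ⌊ key x <? key y ⌋) (λ a b → ⌊ a <? b ⌋)

predL : ∀ {σ D n} → (Fin n → ℕ) → Membership σ D n → ℕ → Fin n → Maybe (Fin n)
predL key m ℓ x =
  selectBest key (λ y → sameList m ℓ x y ∧ ⌊ key y <? key x ⌋) (λ a b → ⌊ b <? a ⌋)

alone : ∀ {σ D n} → Membership σ D n → ℕ → Fin n → Bool
alone {n = n} m ℓ x = and (L.map (λ y → ⌊ x F.≟ y ⌋ ∨ not (sameList m ℓ x y)) (L.allFin n))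

-- all nodes are separated by their length-D prefixes (i.e. every maxLevel ≤ D)
separated : ∀ {σ D n} → Membership σ D n → Bool
separated {D = D} {n = n} m = and (L.map (alone m D) (L.allFin n))

firstAlone : ∀ {σ D n} → Membership σ D n → Fin n → ℕ → ℕ → ℕ
firstAlone m x ℓ zero    = ℓ
firstAlone m x ℓ (suc f) = if alone m ℓ x then ℓ else firstAlone m x (suc ℓ) f

-- x.maxLevel (correct whenever m is separated)
maxLevel : ∀ {σ D n} → Membership σ D n → Fin n → ℕ
maxLevel {D = D} m x = firstAlone m x 0 D

-- Number of forwarding messages sent by the search for k from node v at level ℓ.
searchLoop : ∀ {σ D n} → (Fin n → ℕ) → ℕ → Membership σ D n → ℕ → Fin n → ℕ → ℕ
searchLoop key k m zero v ℓ = 0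
searchLoop key k m (suc f) v ℓ =
  if ⌊ key v ≟ k ⌋ then 0
  else if ⌊ key v <? k ⌋ then goR (succR key m ℓ v)
  else goL (predL key m ℓ v)
  where
  downFrom : ℕ → ℕ
  downFrom zero     = 0
  downFrom (suc ℓ') = searchLoop key k m f v ℓ'
  down : ℕ
  down = downFrom ℓ
  goR : Maybe _ → ℕ
  goR (just y) = if ⌊ key y ≤? k ⌋ then suc (searchLoop key k m f y ℓ) else down
  goR nothing  = down
  goL : Maybe _ → ℕ
  goL (just y) = if ⌊ k ≤? key y ⌋ then suc (searchLoop key k m f y ℓ) else down
  goL nothing  = down

-- Messages of the search: forwarding messages plus the final report message.
-- Fuel n*(D+2)+D+2 exceeds the number of steps (≤ n-1 forwards, ≤ D+1 level decrements).
searchMessages : ∀ {σ D n} → (Fin n → ℕ) → ℕ → Membership σ D n → Fin n → ℕ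
searchMessages {D = D} {n = n} key k m s =
  suc (searchLoop key k m (n * (D + 2) + D + 2) s (maxLevel m s))

-- Worst-case time: messages are sent sequentially, each taking up to one unit.
searchTime : ∀ {σ D n} → (Fin n → ℕ) → ℕ → Membership σ D n → Fin n → ℕ
searchTime key k m s = searchMessages key k m s

-- Σ over all length-D prefix assignments in which all nodes are separated.
-- Dividing by σ^(n*D) gives E[X · 1{all maxLevels ≤ D}].
truncMessages : (σ D n : ℕ) → (Fin n → ℕ) → ℕ → Fin n → ℕ
truncMessages σ D n key k s =
  sum (L.map (λ m → if separated m then searchMessages key k m s else 0) (allMemberships σ D n))

truncTime : (σ D n : ℕ) → (Fin n → ℕ) → ℕ → Fin n → ℕ
truncTime σ D n key k s =
  sum (L.map (λ m → if separated m then searchTime key k m s else 0) (allMemberships σ D n))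

{-# OPTIONS --safe #-}
module Submission where

-- By reflecting the keys we may assume that the search moves towards larger keys,
-- key s ≤ k. Charge each forwarding message to the node y it reaches. When y is
-- reached on level ℓ, it shares s's level-ℓ list while no node z ahead of y
-- (key y < key z ≤ k) shares s's level-(ℓ+1) list, or the search would have jumped
-- there. Hence, if c ≥ ℓ is the last level on which y shares s's list, no node ahead
-- of y is in s's level-(c+1) list. The messages are thus at most one plus the number
-- of such events over all y and c < L, plus the number of y still sharing s's level-L
-- list. Each event is a product of independent per-node events, so its probability
-- factorises: level c contributes (σ−1)σ^−(c+1) Σ_y (1 − σ^−(c+1))^a(y), where the
-- numbers a(y) of nodes ahead of y are distinct, and the geometric series bounds this
-- by σ − 1; level L contributes at most n σ^−L ≤ 1. With L = ⌊log₂ n⌋ + 1 the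
-- expectation is at most 2 + L(σ − 1) = O(log n).

open import Defs

open import Data.Bool using (Bool; true; false; if_then_else_; _∧_; not)
open import Data.Bool.ListAction using (and)
open import Data.Bool.Properties using (∧-conicalˡ; ∧-conicalʳ; ∧-zeroʳ)
open import Data.Empty using (⊥; ⊥-elim)
open import Data.Unit using (⊤; tt)
open import Data.Fin as F using (Fin; zero; suc; toℕ; fromℕ<)
import Data.Fin.Properties as Fin
open import Data.List as L using (List; []; _∷_; _++_)
open import Data.List.Membership.Propositional using (_∈_)
open import Data.List.Membership.Propositional.Properties using (∈-allFin)
open import Data.List.Properties using (≡-dec; foldr-cong; take-take)
open import Data.List.Relation.Unary.Any using (here; there)
open import Data.Maybe using (Maybe; just; nothing)
open import Data.Nat using (ℕ; zero; suc; _+_; _*_; _∸_; _^_; _≤_; _<_; z≤n; s≤s; NonZero)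
import Data.Nat.ListAction as ℕL
open import Data.Nat.Logarithm using (⌊log₂_⌋; ⌊log₂⌋-mono-≤; ⌊log₂[2^n]⌋≡n)
open import Data.Nat.Properties
open import Data.Nat.Solver using (module +-*-Solver)
open import Data.Product using (∃-syntax; _×_; _,_; proj₁; proj₂)
open import Data.Vec as V using (Vec)
open import Function using (_∘_; id)
open import Function.Bundles using (_⇔_; mk⇔)
open import Function.Definitions using (Injective)
open import Relation.Binary.Definitions using (tri<; tri≈; tri>)
open import Relation.Binary.PropositionalEquality
open import Relation.Nullary using (Dec; yes; no; ¬_; contradiction)
open import Relation.Nullary.Decidable using (⌊_⌋; dec-true; dec-false; isYes≗does; does-⇔)

open import Algebra.Properties.Semiring.Sum +-*-semiring
  using (sum; sum-syntax; sum-cong-≗; ∑-distrib-+; ∑-comm; *-distribˡ-sum; sum-remove; sum-replicate-zero)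
open import Algebra.Properties.CommutativeSemigroup +-commutativeSemigroup
  using () renaming (x∙yz≈y∙xz to +-exchange; interchange to +-interchange)
open import Algebra.Properties.CommutativeSemigroup *-commutativeSemigroup
  using () renaming (x∙yz≈y∙xz to *-exchange)
open +-*-Solver using (solve; _:+_; _:*_; _:=_; con)

𝟙 : Bool → ℕ
𝟙 true  = 1
𝟙 false = 0

𝟙≤1 : ∀ b → 𝟙 b ≤ 1
𝟙≤1 true  = ≤-refl
𝟙≤1 false = z≤n

𝟙-mono : ∀ {a b} → (a ≡ true → b ≡ true) → 𝟙 a ≤ 𝟙 b
𝟙-mono {true}  a⇒b rewrite a⇒b refl = ≤-refl
𝟙-mono {false} _   = z≤n

𝟙-∧ : ∀ a b → 𝟙 (a ∧ b) ≡ 𝟙 a * 𝟙 b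
𝟙-∧ true  b = sym (+-identityʳ (𝟙 b))
𝟙-∧ false b = refl

𝟙-∧-not : ∀ a b → (b ≡ true → a ≡ true) → 𝟙 (a ∧ not b) + 𝟙 b ≡ 𝟙 a
𝟙-∧-not true  true  _   = refl
𝟙-∧-not true  false _   = refl
𝟙-∧-not false true  b⇒a = contradiction (b⇒a refl) λ ()
𝟙-∧-not false false _   = refl

⌊⌋-true : ∀ {A : Set} (a? : Dec A) → A → ⌊ a? ⌋ ≡ true
⌊⌋-true a? a = trans (isYes≗does a?) (dec-true a? a)

⌊⌋-false : ∀ {A : Set} (a? : Dec A) → ¬ A → ⌊ a? ⌋ ≡ false
⌊⌋-false a? ¬a = trans (isYes≗does a?) (dec-false a? ¬a)

⌊⌋-sound : ∀ {A : Set} (a? : Dec A) → ⌊ a? ⌋ ≡ true → A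
⌊⌋-sound (yes a) _ = a

⌊⌋-⇔ : ∀ {A B : Set} → A ⇔ B → (a? : Dec A) (b? : Dec B) → ⌊ a? ⌋ ≡ ⌊ b? ⌋
⌊⌋-⇔ A⇔B a? b? = trans (isYes≗does a?) (trans (does-⇔ A⇔B a? b?) (sym (isYes≗does b?)))

suc-≟ : ∀ {n} (i j : Fin n) → ⌊ suc i F.≟ suc j ⌋ ≡ ⌊ i F.≟ j ⌋
suc-≟ i j = ⌊⌋-⇔ (mk⇔ Fin.suc-injective (cong suc)) _ _

-- Finite sums and products

∑-mono-≤ : ∀ {n} {f g : Fin n → ℕ} → (∀ i → f i ≤ g i) → ∑[ i < n ] f i ≤ ∑[ i < n ] g i
∑-mono-≤ {zero}  f≤g = z≤n
∑-mono-≤ {suc n} f≤g = +-mono-≤ (f≤g zero) (∑-mono-≤ (f≤g ∘ suc))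

term≤∑ : ∀ {n} (f : Fin n → ℕ) i → f i ≤ ∑[ j < n ] f j
term≤∑ {suc n} f i = ≤-trans (m≤m+n (f i) _) (≤-reflexive (sym (sum-remove {i = i} f)))

∑-const : ∀ n c → ∑[ i < n ] c ≡ n * c
∑-const zero    c = refl
∑-const (suc n) c = cong (c +_) (∑-const n c)

*-distribʳ-∑ : ∀ {n} c (f : Fin n → ℕ) → sum f * c ≡ ∑[ i < n ] (f i * c)
*-distribʳ-∑ {n} c f = trans (*-comm _ c) (trans (*-distribˡ-sum c f) (sum-cong-≗ (λ i → *-comm c (f i))))

∑-𝟙-insert : ∀ {n} (P Q : Fin n → Bool) (g : Fin n → ℕ) j →
  (∀ i → P i ≡ true → Q i ≡ true) → Q j ≡ true → P j ≡ false →
  g j + ∑[ i < n ] (𝟙 (P i) * g i) ≤ ∑[ i < n ] (𝟙 (Q i) * g i)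
∑-𝟙-insert {suc n} P Q g zero P⊆Q Qj ¬Pj rewrite Qj | ¬Pj | +-identityʳ (g zero) =
  +-monoʳ-≤ (g zero) (∑-mono-≤ λ i → *-monoˡ-≤ (g (suc i)) (𝟙-mono (P⊆Q (suc i))))
∑-𝟙-insert {suc n} P Q g (suc j) P⊆Q Qj ¬Pj = begin
  g (suc j) + (𝟙 (P zero) * g zero + ∑[ i < n ] (𝟙 (P (suc i)) * g (suc i)))
    ≡⟨ +-exchange (g (suc j)) (𝟙 (P zero) * g zero) _ ⟩
  𝟙 (P zero) * g zero + (g (suc j) + ∑[ i < n ] (𝟙 (P (suc i)) * g (suc i)))
    ≤⟨ +-mono-≤ (*-monoˡ-≤ (g zero) (𝟙-mono (P⊆Q zero)))
                (∑-𝟙-insert (P ∘ suc) (Q ∘ suc) (g ∘ suc) j (P⊆Q ∘ suc) Qj ¬Pj) ⟩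
  𝟙 (Q zero) * g zero + ∑[ i < n ] (𝟙 (Q (suc i)) * g (suc i)) ∎
  where open ≤-Reasoning

∏ : ∀ {n} → (Fin n → ℕ) → ℕ
∏ {zero}  f = 1
∏ {suc n} f = f zero * ∏ (f ∘ suc)

prod-syntax : ∀ n → (Fin n → ℕ) → ℕ
prod-syntax _ = ∏

infixl 10 prod-syntax
syntax prod-syntax n (λ i → x) = ∏[ i < n ] x

∏-cong : ∀ {n} {f g : Fin n → ℕ} → (∀ i → f i ≡ g i) → ∏ f ≡ ∏ g
∏-cong {zero}  f≗g = refl
∏-cong {suc n} f≗g = cong₂ _*_ (f≗g zero) (∏-cong (f≗g ∘ suc))

∏-mono-≤ : ∀ {n} {f g : Fin n → ℕ} → (∀ i → f i ≤ g i) → ∏ f ≤ ∏ g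
∏-mono-≤ {zero}  f≤g = ≤-refl
∏-mono-≤ {suc n} f≤g = *-mono-≤ (f≤g zero) (∏-mono-≤ (f≤g ∘ suc))

∏-const : ∀ n c → ∏[ i < n ] c ≡ c ^ n
∏-const zero    c = refl
∏-const (suc n) c = cong (c *_) (∏-const n c)

∏-update : ∀ {n} (y : Fin n) (h g : Fin n → ℕ) →
  ∏[ i < n ] (if ⌊ i F.≟ y ⌋ then h i else g i) * g y ≡ h y * ∏ g
∏-update {suc n} zero h g =
  solve 3 (λ a b c → (a :* b) :* c := a :* (c :* b)) refl (h zero) (∏ (g ∘ suc)) (g zero)
∏-update {suc n} (suc y) h g = begin
  g zero * ∏[ i < n ] (if ⌊ suc i F.≟ suc y ⌋ then h (suc i) else g (suc i)) * g (suc y)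
    ≡⟨ cong (λ p → g zero * p * g (suc y)) (∏-cong λ i → cong (if_then h (suc i) else g (suc i)) (suc-≟ i y)) ⟩
  g zero * ∏[ i < n ] (if ⌊ i F.≟ y ⌋ then h (suc i) else g (suc i)) * g (suc y)
    ≡⟨ *-assoc (g zero) _ (g (suc y)) ⟩
  g zero * (∏[ i < n ] (if ⌊ i F.≟ y ⌋ then h (suc i) else g (suc i)) * g (suc y))
    ≡⟨ cong (g zero *_) (∏-update y (h ∘ suc) (g ∘ suc)) ⟩
  g zero * (h (suc y) * ∏ (g ∘ suc))
    ≡⟨ *-exchange (g zero) (h (suc y)) _ ⟩
  h (suc y) * (g zero * ∏ (g ∘ suc)) ∎
  where open ≡-Reasoning

∏-ones : ∀ {n} {f : Fin n → ℕ} → (∀ i → f i ≡ 1) → ∏ f ≡ 1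
∏-ones {n} f≡1 = trans (∏-cong f≡1) (trans (∏-const n 1) (^-zeroˡ n))

count : ∀ {n} → (Fin n → Bool) → ℕ
count {n} P = ∑[ i < n ] 𝟙 (P i)

count≤n : ∀ {n} (P : Fin n → Bool) → count P ≤ n
count≤n {zero}  P = z≤n
count≤n {suc n} P = +-mono-≤ (𝟙≤1 (P zero)) (count≤n (P ∘ suc))

count-< : ∀ {n} (P Q : Fin n → Bool) j →
  (∀ i → P i ≡ true → Q i ≡ true) → Q j ≡ true → P j ≡ false → count P < count Q
count-< {n} P Q j P⊆Q Qj ¬Pj = begin-strict
  count P                        ≡⟨ sum-cong-≗ (λ i → sym (*-identityʳ (𝟙 (P i)))) ⟩
  ∑[ i < n ] (𝟙 (P i) * 1)       <⟨ ∑-𝟙-insert P Q (λ _ → 1) j P⊆Q Qj ¬Pj ⟩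
  ∑[ i < n ] (𝟙 (Q i) * 1)       ≡⟨ sum-cong-≗ (λ i → *-identityʳ (𝟙 (Q i))) ⟩
  count Q                        ∎
  where open ≤-Reasoning

count-<n : ∀ {n} (P : Fin n → Bool) j → P j ≡ false → count P < n
count-<n {n} P j ¬Pj = ≤-trans (count-< P (λ _ → true) j (λ _ _ → refl) refl ¬Pj)
                              (≤-reflexive (trans (∑-const n 1) (*-identityʳ n)))

count-unique : ∀ {n} (P : Fin n → Bool) → (∀ i j → P i ≡ true → P j ≡ true → i ≡ j) → count P ≤ 1
count-unique {zero}  P unique = z≤n
count-unique {suc n} P unique with P zero in P0
... | true  = ≤-reflexive (cong suc (none (P ∘ suc) λ i Pi → contradiction (unique zero (suc i) P0 Pi) λ ()))
  where
  none : ∀ {k} (R : Fin k → Bool) → (∀ i → R i ≡ true → ⊥) → count R ≡ 0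
  none {zero}  R ¬R = refl
  none {suc k} R ¬R with R zero in R0
  ... | true  = ⊥-elim (¬R zero R0)
  ... | false = none (R ∘ suc) (¬R ∘ suc)
... | false = count-unique (P ∘ suc) λ i j Pi Pj → Fin.suc-injective (unique (suc i) (suc j) Pi Pj)

count-≟ : ∀ {n} (a : Fin n) → count (λ i → ⌊ i F.≟ a ⌋) ≡ 1
count-≟ a = ≤-antisym
  (count-unique _ λ i j i≡a j≡a → trans (⌊⌋-sound (i F.≟ a) i≡a) (sym (⌊⌋-sound (j F.≟ a) j≡a)))
  (≤-trans (≤-reflexive (cong 𝟙 (sym (⌊⌋-true (a F.≟ a) refl)))) (term≤∑ _ a))

∏-if : ∀ {n} (P : Fin n → Bool) b c → ∏[ i < n ] (if P i then b else c) ≡ b ^ count P * c ^ (n ∸ count P)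
∏-if {zero}  P b c = refl
∏-if {suc n} P b c with P zero
... | true  = trans (cong (b *_) (∏-if (P ∘ suc) b c)) (sym (*-assoc b _ _))
... | false = begin
  c * ∏[ i < n ] (if P (suc i) then b else c)   ≡⟨ cong (c *_) (∏-if (P ∘ suc) b c) ⟩
  c * (b ^ k * c ^ (n ∸ k))                      ≡⟨ *-exchange c (b ^ k) _ ⟩
  b ^ k * c ^ suc (n ∸ k)                        ≡⟨ cong (λ e → b ^ k * c ^ e) (sym (+-∸-assoc 1 (count≤n (P ∘ suc)))) ⟩
  b ^ k * c ^ (suc n ∸ k)                        ∎
  where
  open ≡-Reasoning
  k : ℕ
  k = count (P ∘ suc)

∑-injective-≤ : ∀ {n N} (Y : Fin n → Bool) (r : Fin n → ℕ) (g : ℕ → ℕ) →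
  (∀ y → Y y ≡ true → r y < N) →
  (∀ y y′ → Y y ≡ true → Y y′ ≡ true → r y ≡ r y′ → y ≡ y′) →
  ∑[ y < n ] (𝟙 (Y y) * g (r y)) ≤ ∑[ j < N ] g (toℕ j)
∑-injective-≤ {n} {N} Y r g r<N r-inj = begin
  ∑[ y < n ] (𝟙 (Y y) * g (r y))
    ≤⟨ ∑-mono-≤ spread ⟩
  ∑[ y < n ] ∑[ j < N ] (𝟙 (hits y j) * g (toℕ j))
    ≡⟨ ∑-comm (λ y j → 𝟙 (hits y j) * g (toℕ j)) ⟩
  ∑[ j < N ] ∑[ y < n ] (𝟙 (hits y j) * g (toℕ j))
    ≡⟨ sum-cong-≗ (λ j → sym (*-distribʳ-∑ (g (toℕ j)) (λ y → 𝟙 (hits y j)))) ⟩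
  ∑[ j < N ] (count (λ y → hits y j) * g (toℕ j))
    ≤⟨ ∑-mono-≤ (λ j → *-monoˡ-≤ (g (toℕ j)) (count-unique _ (unique j))) ⟩
  ∑[ j < N ] (1 * g (toℕ j))
    ≡⟨ sum-cong-≗ {N} (λ j → *-identityˡ (g (toℕ j))) ⟩
  ∑[ j < N ] g (toℕ j) ∎
  where
  open ≤-Reasoning
  hits : Fin n → Fin N → Bool
  hits y j = Y y ∧ ⌊ r y ≟ toℕ j ⌋
  spread : ∀ y → 𝟙 (Y y) * g (r y) ≤ ∑[ j < N ] (𝟙 (hits y j) * g (toℕ j))
  spread y with Y y in Yy
  ... | false = z≤n
  ... | true  = ≤-trans (≤-reflexive hit) (term≤∑ (λ j → 𝟙 ⌊ r y ≟ toℕ j ⌋ * g (toℕ j)) j)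
    where
    j : Fin N
    j = fromℕ< (r<N y Yy)
    j≡ : toℕ j ≡ r y
    j≡ = Fin.toℕ-fromℕ< (r<N y Yy)
    hit : 1 * g (r y) ≡ 𝟙 ⌊ r y ≟ toℕ j ⌋ * g (toℕ j)
    hit = sym (cong₂ (λ b t → 𝟙 b * g t) (⌊⌋-true (r y ≟ _) (sym j≡)) j≡)
  unique : ∀ j y y′ → hits y j ≡ true → hits y′ j ≡ true → y ≡ y′
  unique j y y′ h h′ = r-inj y y′ (∧-conicalˡ _ _ h) (∧-conicalˡ _ _ h′)
    (trans (⌊⌋-sound (r y ≟ _) (∧-conicalʳ _ _ h)) (sym (⌊⌋-sound (r y′ ≟ _) (∧-conicalʳ _ _ h′))))

geometric : ∀ n b d →
  d * ∑[ j < n ] (b ^ toℕ j * (b + d) ^ (n ∸ toℕ j)) + (b + d) * b ^ n ≡ (b + d) ^ suc n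
geometric zero    b d = cong (_+ (b + d) * 1) (*-zeroʳ d)
geometric (suc n) b d = begin
  d * (1 * t ^ suc n + ∑[ j < n ] (b * b ^ toℕ j * t ^ (n ∸ toℕ j))) + t * (b * b ^ n)
    ≡⟨ cong (λ x → d * (1 * t ^ suc n + x) + t * (b * b ^ n)) b*S ⟩
  d * (1 * t ^ suc n + b * S) + t * (b * b ^ n)
    ≡⟨ solve 5 (λ d t₁ b S x → d :* (con 1 :* t₁ :+ b :* S) :+ (b :+ d) :* (b :* x)
                            := d :* t₁ :+ b :* (d :* S :+ (b :+ d) :* x)) refl d (t ^ suc n) b S (b ^ n) ⟩
  d * t ^ suc n + b * (d * S + t * b ^ n)
    ≡⟨ cong (λ x → d * t ^ suc n + b * x) (geometric n b d) ⟩
  d * t ^ suc n + b * t ^ suc n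
    ≡⟨ sym (*-distribʳ-+ (t ^ suc n) d b) ⟩
  (d + b) * t ^ suc n
    ≡⟨ cong (_* t ^ suc n) (+-comm d b) ⟩
  t * t ^ suc n ∎
  where
  open ≡-Reasoning
  t : ℕ
  t = b + d
  S : ℕ
  S = ∑[ j < n ] (b ^ toℕ j * t ^ (n ∸ toℕ j))
  b*S : ∑[ j < n ] (b * b ^ toℕ j * t ^ (n ∸ toℕ j)) ≡ b * S
  b*S = trans (sum-cong-≗ {n} λ j → *-assoc b _ _) (sym (*-distribˡ-sum {n} b (λ j → b ^ toℕ j * t ^ (n ∸ toℕ j))))

private
  variable
    A B : Set

∑∈ : List A → (A → ℕ) → ℕ
∑∈ xs f = ℕL.sum (L.map f xs)

infixl 10 ∑∈
syntax ∑∈ xs (λ x → e) = ∑[ x ∈ xs ] e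

∑∈-cong : ∀ (xs : List A) {f g : A → ℕ} → (∀ x → f x ≡ g x) → ∑∈ xs f ≡ ∑∈ xs g
∑∈-cong []       f≗g = refl
∑∈-cong (x ∷ xs) f≗g = cong₂ _+_ (f≗g x) (∑∈-cong xs f≗g)

∑∈-mono-≤ : ∀ (xs : List A) {f g : A → ℕ} → (∀ x → f x ≤ g x) → ∑∈ xs f ≤ ∑∈ xs g
∑∈-mono-≤ []       f≤g = z≤n
∑∈-mono-≤ (x ∷ xs) f≤g = +-mono-≤ (f≤g x) (∑∈-mono-≤ xs f≤g)

∑∈-zero : ∀ (xs : List A) → ∑[ x ∈ xs ] 0 ≡ 0
∑∈-zero []       = refl
∑∈-zero (x ∷ xs) = ∑∈-zero xs

∑∈-zero-≤ : ∀ (xs : List A) {f : A → ℕ} c → (∀ x → f x ≡ 0) → ∑∈ xs f ≤ c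
∑∈-zero-≤ xs c f≡0 = ≤-trans (≤-reflexive (trans (∑∈-cong xs f≡0) (∑∈-zero xs))) z≤n

∑∈-distrib-+ : ∀ (xs : List A) (f g : A → ℕ) → ∑[ x ∈ xs ] (f x + g x) ≡ ∑∈ xs f + ∑∈ xs g
∑∈-distrib-+ []       f g = refl
∑∈-distrib-+ (x ∷ xs) f g = trans (cong (f x + g x +_) (∑∈-distrib-+ xs f g)) (+-interchange (f x) (g x) _ _)

*-distribˡ-∑∈ : ∀ c (xs : List A) (f : A → ℕ) → c * ∑∈ xs f ≡ ∑[ x ∈ xs ] (c * f x)
*-distribˡ-∑∈ c []       f = *-zeroʳ c
*-distribˡ-∑∈ c (x ∷ xs) f = trans (*-distribˡ-+ c (f x) _) (cong (c * f x +_) (*-distribˡ-∑∈ c xs f))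

*-distribʳ-∑∈ : ∀ c (xs : List A) (f : A → ℕ) → ∑∈ xs f * c ≡ ∑[ x ∈ xs ] (f x * c)
*-distribʳ-∑∈ c xs f = trans (*-comm _ c) (trans (*-distribˡ-∑∈ c xs f) (∑∈-cong xs λ x → *-comm c (f x)))

∑∈-∑-comm : ∀ {n} (xs : List A) (f : A → Fin n → ℕ) →
  ∑[ x ∈ xs ] ∑[ i < n ] f x i ≡ ∑[ i < n ] ∑[ x ∈ xs ] f x i
∑∈-∑-comm {n = n} []       f = sym (sum-replicate-zero n)
∑∈-∑-comm {n = n} (x ∷ xs) f =
  trans (cong (sum (f x) +_) (∑∈-∑-comm xs f)) (sym (∑-distrib-+ (f x) (λ i → ∑[ y ∈ xs ] f y i)))

∑∈-comm : (xs : List A) (ys : List B) (f : A → B → ℕ) →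
  ∑[ x ∈ xs ] ∑[ y ∈ ys ] f x y ≡ ∑[ y ∈ ys ] ∑[ x ∈ xs ] f x y
∑∈-comm []       ys f = sym (∑∈-zero ys)
∑∈-comm (x ∷ xs) ys f =
  trans (cong (∑∈ ys (f x) +_) (∑∈-comm xs ys f)) (sym (∑∈-distrib-+ ys (f x) (λ y → ∑[ x′ ∈ xs ] f x′ y)))

∑∈-tabulate : ∀ {n} (g : Fin n → A) (f : A → ℕ) → ∑∈ (L.tabulate g) f ≡ ∑[ i < n ] f (g i)
∑∈-tabulate {n = zero}  g f = refl
∑∈-tabulate {n = suc n} g f = cong (f (g zero) +_) (∑∈-tabulate (g ∘ suc) f)

∑∈-allFin : ∀ {n} (f : Fin n → ℕ) → ∑∈ (L.allFin n) f ≡ ∑[ i < n ] f i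
∑∈-allFin = ∑∈-tabulate id

∑∈-++ : ∀ (xs ys : List A) (f : A → ℕ) → ∑∈ (xs ++ ys) f ≡ ∑∈ xs f + ∑∈ ys f
∑∈-++ []       ys f = refl
∑∈-++ (x ∷ xs) ys f = trans (cong (f x +_) (∑∈-++ xs ys f)) (sym (+-assoc (f x) _ _))

∑∈-map : ∀ (g : A → B) (xs : List A) (f : B → ℕ) → ∑∈ (L.map g xs) f ≡ ∑[ x ∈ xs ] f (g x)
∑∈-map g []       f = refl
∑∈-map g (x ∷ xs) f = cong (f (g x) +_) (∑∈-map g xs f)

∑∈-concatMap : ∀ (g : A → List B) (xs : List A) (f : B → ℕ) →
  ∑∈ (L.concatMap g xs) f ≡ ∑[ x ∈ xs ] ∑∈ (g x) f
∑∈-concatMap g []       f = refl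
∑∈-concatMap g (x ∷ xs) f = trans (∑∈-++ (g x) _ f) (cong (∑∈ (g x) f +_) (∑∈-concatMap g xs f))

∑∈-allVecs-suc : ∀ n (xs : List A) (f : Vec A (suc n) → ℕ) →
  ∑[ v ∈ allVecs (suc n) xs ] f v ≡ ∑[ x ∈ xs ] ∑[ v ∈ allVecs n xs ] f (x V.∷ v)
∑∈-allVecs-suc n xs f = trans (∑∈-concatMap _ xs f) (∑∈-cong xs λ x → ∑∈-map (x V.∷_) (allVecs n xs) f)

∑-allVecs-∏ : ∀ {A : Set} n (xs : List A) (f : Fin n → A → ℕ) →
  ∑[ v ∈ allVecs n xs ] ∏[ i < n ] f i (V.lookup v i) ≡ ∏[ i < n ] ∑[ x ∈ xs ] f i x
∑-allVecs-∏ zero    xs f = refl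
∑-allVecs-∏ {A} (suc n) xs f = begin
  ∑[ v ∈ allVecs (suc n) xs ] ∏[ i < suc n ] f i (V.lookup v i)
    ≡⟨ ∑∈-allVecs-suc n xs _ ⟩
  ∑[ x ∈ xs ] ∑[ v ∈ allVecs n xs ] (f zero x * rest v)
    ≡⟨ ∑∈-cong xs (λ x → sym (*-distribˡ-∑∈ (f zero x) (allVecs n xs) rest)) ⟩
  ∑[ x ∈ xs ] (f zero x * ∑∈ (allVecs n xs) rest)
    ≡⟨ sym (*-distribʳ-∑∈ _ xs (f zero)) ⟩
  ∑∈ xs (f zero) * ∑∈ (allVecs n xs) rest
    ≡⟨ cong (∑∈ xs (f zero) *_) (∑-allVecs-∏ n xs (f ∘ suc)) ⟩
  ∑∈ xs (f zero) * ∏[ i < n ] ∑[ x ∈ xs ] f (suc i) x ∎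
  where
  open ≡-Reasoning
  rest : Vec A n → ℕ
  rest v = ∏[ i < n ] f (suc i) (V.lookup v i)

-- Conditioned on the coordinate s, the other coordinates are independent.
∑-allVecs-∏-pinned-≤ : ∀ {A : Set} n (xs : List A) (s : Fin n) (f : Fin n → A → A → ℕ) (c : Fin n → ℕ) →
  (∀ i → i ≢ s → ∀ w → ∑[ x ∈ xs ] f i x w ≤ c i) → ∑[ x ∈ xs ] f s x x ≤ c s →
  ∑[ v ∈ allVecs n xs ] ∏[ i < n ] f i (V.lookup v i) (V.lookup v s) ≤ ∏ c
∑-allVecs-∏-pinned-≤ {A} (suc n) xs zero f c bound bound-s = begin
  ∑[ v ∈ allVecs (suc n) xs ] ∏[ i < suc n ] f i (V.lookup v i) (V.lookup v zero)
    ≡⟨ ∑∈-allVecs-suc n xs _ ⟩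
  ∑[ x ∈ xs ] ∑[ v ∈ allVecs n xs ] (f zero x x * rest x v)
    ≡⟨ ∑∈-cong xs (λ x → sym (*-distribˡ-∑∈ (f zero x x) (allVecs n xs) (rest x))) ⟩
  ∑[ x ∈ xs ] (f zero x x * ∑∈ (allVecs n xs) (rest x))
    ≡⟨ ∑∈-cong xs (λ x → cong (f zero x x *_) (∑-allVecs-∏ n xs λ i y → f (suc i) y x)) ⟩
  ∑[ x ∈ xs ] (f zero x x * ∏[ i < n ] ∑[ y ∈ xs ] f (suc i) y x)
    ≤⟨ ∑∈-mono-≤ xs (λ x → *-monoʳ-≤ (f zero x x) (∏-mono-≤ λ i → bound (suc i) (λ ()) x)) ⟩
  ∑[ x ∈ xs ] (f zero x x * ∏ (c ∘ suc))
    ≡⟨ sym (*-distribʳ-∑∈ _ xs (λ x → f zero x x)) ⟩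
  ∑[ x ∈ xs ] f zero x x * ∏ (c ∘ suc)
    ≤⟨ *-monoˡ-≤ (∏ (c ∘ suc)) bound-s ⟩
  ∏ c ∎
  where
  open ≤-Reasoning
  rest : A → Vec A n → ℕ
  rest x v = ∏[ i < n ] f (suc i) (V.lookup v i) x
∑-allVecs-∏-pinned-≤ {A} (suc n) xs (suc s) f c bound bound-s = begin
  ∑[ v ∈ allVecs (suc n) xs ] ∏[ i < suc n ] f i (V.lookup v i) (V.lookup v (suc s))
    ≡⟨ ∑∈-allVecs-suc n xs _ ⟩
  ∑[ x ∈ xs ] ∑[ v ∈ allVecs n xs ] (f zero x (V.lookup v s) * rest v)
    ≡⟨ ∑∈-comm xs (allVecs n xs) _ ⟩
  ∑[ v ∈ allVecs n xs ] ∑[ x ∈ xs ] (f zero x (V.lookup v s) * rest v)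
    ≡⟨ ∑∈-cong (allVecs n xs) (λ v → sym (*-distribʳ-∑∈ (rest v) xs λ x → f zero x (V.lookup v s))) ⟩
  ∑[ v ∈ allVecs n xs ] (∑[ x ∈ xs ] f zero x (V.lookup v s) * rest v)
    ≤⟨ ∑∈-mono-≤ (allVecs n xs) (λ v → *-monoˡ-≤ (rest v) (bound zero (λ ()) (V.lookup v s))) ⟩
  ∑[ v ∈ allVecs n xs ] (c zero * rest v)
    ≡⟨ sym (*-distribˡ-∑∈ (c zero) (allVecs n xs) rest) ⟩
  c zero * ∑∈ (allVecs n xs) rest
    ≤⟨ *-monoʳ-≤ (c zero) (∑-allVecs-∏-pinned-≤ n xs s (f ∘ suc) (c ∘ suc)
                             (λ i i≢s → bound (suc i) (i≢s ∘ Fin.suc-injective)) bound-s) ⟩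
  ∏ c ∎
  where
  open ≤-Reasoning
  rest : Vec A n → ℕ
  rest v = ∏[ i < n ] f (suc i) (V.lookup v i) (V.lookup v s)

∑-allVecs-1 : ∀ n (xs : List A) → ∑[ v ∈ allVecs n xs ] 1 ≡ (∑[ x ∈ xs ] 1) ^ n
∑-allVecs-1 n xs = begin
  ∑[ v ∈ allVecs n xs ] 1                      ≡⟨ ∑∈-cong (allVecs n xs) (λ _ → sym (trans (∏-const n 1) (^-zeroˡ n))) ⟩
  ∑[ v ∈ allVecs n xs ] ∏[ i < n ] 1           ≡⟨ ∑-allVecs-∏ n xs (λ _ _ → 1) ⟩
  ∏[ i < n ] ∑[ x ∈ xs ] 1                     ≡⟨ ∏-const n _ ⟩
  (∑[ x ∈ xs ] 1) ^ n                          ∎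
  where open ≡-Reasoning

and-map : ∀ (p : A → Bool) xs → and (L.map p xs) ≡ true → ∀ {y} → y ∈ xs → p y ≡ true
and-map p (x ∷ xs) all-p (here refl) = ∧-conicalˡ _ _ all-p
and-map p (x ∷ xs) all-p (there y∈) = and-map p xs (∧-conicalʳ _ _ all-p) y∈

-- Prefixes of membership words

Word : ℕ → ℕ → Set
Word σ D = Vec (Fin σ) D

words : ∀ σ D → List (Word σ D)
words σ D = allVecs D (L.allFin σ)

count-words : ∀ σ D → ∑[ x ∈ words σ D ] 1 ≡ σ ^ D
count-words σ D = trans (∑-allVecs-1 D (L.allFin σ))
  (cong (_^ D) (trans (∑∈-allFin {σ} (λ _ → 1)) (trans (∑-const σ 1) (*-identityʳ σ))))

-- sameList m ℓ x y is agree ℓ (lookup m x) (lookup m y) by definition.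
agree : ∀ {σ D} → ℕ → Word σ D → Word σ D → Bool
agree ℓ u w = ⌊ ≡-dec F._≟_ (prefix ℓ u) (prefix ℓ w) ⌋

module _ {σ D : ℕ} where

  agree-refl : ∀ ℓ (u : Word σ D) → agree ℓ u u ≡ true
  agree-refl ℓ u = ⌊⌋-true (≡-dec F._≟_ _ _) refl

  agree-sym : ∀ ℓ (u w : Word σ D) → agree ℓ u w ≡ true → agree ℓ w u ≡ true
  agree-sym ℓ u w u~w = ⌊⌋-true (≡-dec F._≟_ _ _) (sym (⌊⌋-sound (≡-dec F._≟_ _ _) u~w))

  agree-symᶜ : ∀ ℓ (u w : Word σ D) → agree ℓ u w ≡ false → agree ℓ w u ≡ false
  agree-symᶜ ℓ u w u≁w with agree ℓ w u in w~u
  ... | false = refl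
  ... | true  = trans (sym (agree-sym ℓ w u w~u)) u≁w

  agree-trans : ∀ ℓ (u v w : Word σ D) → agree ℓ u v ≡ true → agree ℓ v w ≡ true → agree ℓ u w ≡ true
  agree-trans ℓ u v w u~v v~w =
    ⌊⌋-true (≡-dec F._≟_ _ _) (trans (⌊⌋-sound (≡-dec F._≟_ _ _) u~v) (⌊⌋-sound (≡-dec F._≟_ _ _) v~w))

  agree-antitone : ∀ {ℓ′ ℓ} (u w : Word σ D) → ℓ′ ≤ ℓ → agree ℓ u w ≡ true → agree ℓ′ u w ≡ true
  agree-antitone {ℓ′} {ℓ} u w ℓ′≤ℓ u~w = ⌊⌋-true (≡-dec F._≟_ _ _) (begin
    L.take ℓ′ U              ≡⟨ shorter U ⟩
    L.take ℓ′ (L.take ℓ U)   ≡⟨ cong (L.take ℓ′) (⌊⌋-sound (≡-dec F._≟_ _ _) u~w) ⟩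
    L.take ℓ′ (L.take ℓ W)   ≡⟨ shorter W ⟨
    L.take ℓ′ W              ∎)
    where
    open ≡-Reasoning
    U W : List (Fin σ)
    U = V.toList u
    W = V.toList w
    shorter : ∀ xs → L.take ℓ′ xs ≡ L.take ℓ′ (L.take ℓ xs)
    shorter xs = trans (cong (λ i → L.take i xs) (sym (m≤n⇒m⊓n≡m ℓ′≤ℓ))) (sym (take-take ℓ′ ℓ xs))

  agree-antitoneᶜ : ∀ {ℓ′ ℓ} (u w : Word σ D) → ℓ′ ≤ ℓ → agree ℓ′ u w ≡ false → agree ℓ u w ≡ false
  agree-antitoneᶜ {ℓ = ℓ} u w ℓ′≤ℓ ¬u~w with agree ℓ u w in u~w
  ... | false = refl
  ... | true  = trans (sym (agree-antitone u w ℓ′≤ℓ u~w)) ¬u~w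

  agree-∷ : ∀ j a b (u w : Word σ D) → agree (suc j) (a V.∷ u) (b V.∷ w) ≡ ⌊ a F.≟ b ⌋ ∧ agree j u w
  agree-∷ j a b u w = trans (isYes≗does (≡-dec F._≟_ _ _))
    (sym (cong₂ _∧_ (isYes≗does (a F.≟ b)) (isYes≗does (≡-dec F._≟_ (prefix j u) (prefix j w)))))

count-agree : ∀ σ D j (w : Word σ D) → ∑[ x ∈ words σ D ] 𝟙 (agree j x w) ≡ σ ^ (D ∸ j)
count-agree σ zero    zero    V.[] = refl
count-agree σ zero    (suc j) V.[] = refl
count-agree σ (suc D) zero    w    = count-words σ (suc D)
count-agree σ (suc D) (suc j) (a V.∷ w) = begin
  ∑[ x ∈ words σ (suc D) ] 𝟙 (agree (suc j) x (a V.∷ w))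
    ≡⟨ ∑∈-allVecs-suc D (L.allFin σ) _ ⟩
  ∑[ b ∈ L.allFin σ ] ∑[ x ∈ words σ D ] 𝟙 (agree (suc j) (b V.∷ x) (a V.∷ w))
    ≡⟨ ∑∈-cong (L.allFin σ) (λ b → ∑∈-cong (words σ D) λ x →
         trans (cong 𝟙 (agree-∷ j b a x w)) (𝟙-∧ ⌊ b F.≟ a ⌋ (agree j x w))) ⟩
  ∑[ b ∈ L.allFin σ ] ∑[ x ∈ words σ D ] (𝟙 ⌊ b F.≟ a ⌋ * 𝟙 (agree j x w))
    ≡⟨ ∑∈-cong (L.allFin σ) (λ b → sym (*-distribˡ-∑∈ (𝟙 ⌊ b F.≟ a ⌋) (words σ D) _)) ⟩
  ∑[ b ∈ L.allFin σ ] (𝟙 ⌊ b F.≟ a ⌋ * ∑[ x ∈ words σ D ] 𝟙 (agree j x w))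
    ≡⟨ sym (*-distribʳ-∑∈ _ (L.allFin σ) _) ⟩
  ∑[ b ∈ L.allFin σ ] 𝟙 ⌊ b F.≟ a ⌋ * ∑[ x ∈ words σ D ] 𝟙 (agree j x w)
    ≡⟨ cong₂ _*_ (trans (∑∈-allFin (λ b → 𝟙 ⌊ b F.≟ a ⌋)) (count-≟ a)) (count-agree σ D j w) ⟩
  1 * σ ^ (D ∸ j)
    ≡⟨ *-identityˡ _ ⟩
  σ ^ (D ∸ j) ∎
  where open ≡-Reasoning

count-band : ∀ σ D {j j′} (w : Word σ D) → j ≤ j′ →
  ∑[ x ∈ words σ D ] 𝟙 (agree j x w ∧ not (agree j′ x w)) ≡ σ ^ (D ∸ j) ∸ σ ^ (D ∸ j′)
count-band σ D {j} {j′} w j≤j′ = begin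
  band                                                      ≡⟨ m+n∸n≡m band c′ ⟨
  band + c′ ∸ c′                                            ≡⟨ cong (λ t → band + t ∸ c′) (count-agree σ D j′ w) ⟨
  band + ∑[ x ∈ words σ D ] 𝟙 (agree j′ x w) ∸ c′           ≡⟨ cong (_∸ c′) (∑∈-distrib-+ (words σ D) _ _) ⟨
  ∑[ x ∈ words σ D ] (𝟙 (agree j x w ∧ not (agree j′ x w)) + 𝟙 (agree j′ x w)) ∸ c′
    ≡⟨ cong (_∸ c′) (∑∈-cong (words σ D) λ x → 𝟙-∧-not _ _ (agree-antitone x w j≤j′)) ⟩
  ∑[ x ∈ words σ D ] 𝟙 (agree j x w) ∸ c′                   ≡⟨ cong (_∸ c′) (count-agree σ D j w) ⟩
  σ ^ (D ∸ j) ∸ c′                                          ∎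
  where
  open ≡-Reasoning
  band c′ : ℕ
  band = ∑[ x ∈ words σ D ] 𝟙 (agree j x w ∧ not (agree j′ x w))
  c′ = σ ^ (D ∸ j′)

-- Successor selection and mirror symmetry

module _ {A : Set} (key : A → ℕ) (ok : A → Bool) where

  IsLeast : List A → Maybe A → Set
  IsLeast xs nothing  = ∀ y → y ∈ xs → ok y ≡ false
  IsLeast xs (just z) = ok z ≡ true × (∀ y → y ∈ xs → ok y ≡ true → key z ≤ key y)

  foldr-least : (step : A → Maybe A → Maybe A) →
    (∀ a → step a nothing ≡ (if ok a then just a else nothing)) →
    (∀ a z → step a (just z) ≡ (if ok a ∧ ⌊ key a <? key z ⌋ then just a else just z)) →
    ∀ xs → IsLeast xs (L.foldr step nothing xs)
  foldr-least step step-nothing step-just []       = λ _ ()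
  foldr-least step step-nothing step-just (a ∷ xs) =
    extend (L.foldr step nothing xs) (foldr-least step step-nothing step-just xs)
    where
    extend : ∀ r → IsLeast xs r → IsLeast (a ∷ xs) (step a r)
    extend nothing least rewrite step-nothing a with ok a in ok-a
    ... | true  = ok-a , λ { _ (here refl) _     → ≤-refl
                           ; y (there y∈) ok-y → contradiction (trans (sym ok-y) (least y y∈)) λ () }
    ... | false = λ { _ (here refl) → ok-a ; y (there y∈) → least y y∈ }
    extend (just z) (ok-z , least) rewrite step-just a z with ok a in ok-a | key a <? key z
    ... | true  | yes a<z = ok-a , λ { _ (here refl) _     → ≤-refl
                                     ; y (there y∈) ok-y → ≤-trans (<⇒≤ a<z) (least y y∈ ok-y) }
    ... | true  | no  a≮z = ok-z , λ { _ (here refl) _     → ≮⇒≥ a≮z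
                                     ; y (there y∈) ok-y → least y y∈ ok-y }
    ... | false | _       = ok-z , λ { _ (here refl) ok-y → contradiction (trans (sym ok-a) ok-y) λ ()
                                     ; y (there y∈) ok-y → least y y∈ ok-y }

module _ {σ D n : ℕ} (key : Fin n → ℕ) (m : Membership σ D n) (ℓ : ℕ) (v : Fin n) where

  private
    candidate : Fin n → Bool
    candidate y = sameList m ℓ v y ∧ ⌊ key v <? key y ⌋

  succR-least : IsLeast key candidate (L.allFin n) (succR key m ℓ v)
  succR-least = foldr-least key candidate _ (λ _ → refl) (λ _ _ → refl) (L.allFin n)

  succR-sound : ∀ {y} → succR key m ℓ v ≡ just y → sameList m ℓ v y ≡ true × key v < key y
  succR-sound next with succR key m ℓ v | succR-least
  succR-sound refl | just y | cand-y , _ = ∧-conicalˡ _ _ cand-y , ⌊⌋-sound (key v <? key y) (∧-conicalʳ _ _ cand-y)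

  succR-complete : ∀ z → sameList m ℓ v z ≡ true → key v < key z → ∃[ y ] (succR key m ℓ v ≡ just y × key y ≤ key z)
  succR-complete z v~z v<z = bounded succR-least
    where
    cand-z : candidate z ≡ true
    cand-z = cong₂ _∧_ v~z (⌊⌋-true (key v <? key z) v<z)
    bounded : ∀ {r} → IsLeast key candidate (L.allFin n) r → ∃[ y ] (r ≡ just y × key y ≤ key z)
    bounded {nothing} none        = contradiction (trans (sym (none z (∈-allFin z))) cand-z) λ ()
    bounded {just y}  (_ , least) = y , refl , least z (∈-allFin z) cand-z

selectBest-cong : ∀ {n} {key key′ : Fin n → ℕ} {ok ok′ : Fin n → Bool} {better better′ : ℕ → ℕ → Bool} →
  (∀ y → ok y ≡ ok′ y) → (∀ y z → better (key y) (key z) ≡ better′ (key′ y) (key′ z)) →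
  selectBest key ok better ≡ selectBest key′ ok′ better′
selectBest-cong {n} ok≗ better≗ = foldr-cong
  (λ { x nothing  → cong (λ b → if b then just x else nothing) (ok≗ x)
     ; x (just z) → cong (λ b → if b then just x else just z) (cong₂ _∧_ (ok≗ x) (better≗ x z)) })
  refl (L.allFin n)

-- Reflecting the keys through K exchanges the two directions of the search.
module Mirror {n : ℕ} (key : Fin n → ℕ) (k K : ℕ) (key≤K : ∀ v → key v ≤ K) (k≤K : k ≤ K) where

  key′ : Fin n → ℕ
  key′ v = K ∸ key v

  k′ : ℕ
  k′ = K ∸ k

  private
    flip-< : ∀ {a b} → a ≤ K → ⌊ K ∸ a <? K ∸ b ⌋ ≡ ⌊ b <? a ⌋
    flip-< a≤K = ⌊⌋-⇔ (mk⇔ ∸-cancelʳ-< (λ b<a → ∸-monoʳ-< b<a a≤K)) _ _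

    flip-≤ : ∀ {a b} → b ≤ K → ⌊ K ∸ a ≤? K ∸ b ⌋ ≡ ⌊ b ≤? a ⌋
    flip-≤ b≤K = ⌊⌋-⇔ (mk⇔ (∸-cancelʳ-≤ b≤K) (∸-monoʳ-≤ K)) _ _

    flip-≟ : ∀ {a b} → a ≤ K → b ≤ K → ⌊ K ∸ a ≟ K ∸ b ⌋ ≡ ⌊ a ≟ b ⌋
    flip-≟ a≤K b≤K = ⌊⌋-⇔ (mk⇔ (∸-cancelˡ-≡ a≤K b≤K) (cong (K ∸_))) _ _

  key′-injective : Injective _≡_ _≡_ key → Injective _≡_ _≡_ key′
  key′-injective inj {u} {v} eq = inj (∸-cancelˡ-≡ (key≤K u) (key≤K v) eq)

  module _ {σ D : ℕ} (m : Membership σ D n) where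

    succR-mirror : ∀ ℓ v → succR key′ m ℓ v ≡ predL key m ℓ v
    succR-mirror ℓ v = selectBest-cong (λ y → cong (sameList m ℓ v y ∧_) (flip-< (key≤K v)))
                                       (λ y z → flip-< (key≤K y))

    predL-mirror : ∀ ℓ v → predL key′ m ℓ v ≡ succR key m ℓ v
    predL-mirror ℓ v = selectBest-cong (λ y → cong (sameList m ℓ v y ∧_) (flip-< (key≤K y)))
                                       (λ y z → flip-< (key≤K z))

    searchLoop-mirror : ∀ f v ℓ → searchLoop key′ k′ m f v ℓ ≡ searchLoop key k m f v ℓ
    searchLoop-mirror zero    v ℓ = refl
    searchLoop-mirror (suc f) v ℓ rewrite flip-≟ (key≤K v) k≤K | flip-< {b = k} (key≤K v) with key v ≟ k
    ... | yes _ = refl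
    ... | no v≢k with key v <? k
    ... | yes v<k rewrite ⌊⌋-false (k <? key v) (<⇒≯ v<k) | predL-mirror ℓ v with succR key m ℓ v
    ...   | just y rewrite flip-≤ {k} (key≤K y) with key y ≤? k
    ...     | yes _ = cong suc (searchLoop-mirror f y ℓ)
    ...     | no _ with ℓ
    ...       | zero   = refl
    ...       | suc ℓ′ = searchLoop-mirror f v ℓ′
    searchLoop-mirror (suc f) v ℓ | no v≢k | yes v<k | nothing with ℓ
    ...       | zero   = refl
    ...       | suc ℓ′ = searchLoop-mirror f v ℓ′
    searchLoop-mirror (suc f) v ℓ | no v≢k | no v≮k
      rewrite ⌊⌋-true (k <? key v) (≤∧≢⇒< (≮⇒≥ v≮k) (v≢k ∘ sym)) | succR-mirror ℓ v with predL key m ℓ v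
    ...   | just y rewrite flip-≤ {key y} k≤K with k ≤? key y
    ...     | yes _ = cong suc (searchLoop-mirror f y ℓ)
    ...     | no _ with ℓ
    ...       | zero   = refl
    ...       | suc ℓ′ = searchLoop-mirror f v ℓ′
    searchLoop-mirror (suc f) v ℓ | no v≢k | no v≮k | nothing with ℓ
    ...       | zero   = refl
    ...       | suc ℓ′ = searchLoop-mirror f v ℓ′

    searchMessages-mirror : ∀ s → searchMessages key′ k′ m s ≡ searchMessages key k m s
    searchMessages-mirror s = cong suc (searchLoop-mirror (n * (D + 2) + D + 2) s (maxLevel m s))

module _ {σ D n : ℕ} (m : Membership σ D n) where

  alone-apart : ∀ ℓ x → alone m ℓ x ≡ true → ∀ y → y ≢ x → sameList m ℓ x y ≡ false
  alone-apart ℓ x alone-x y y≢x with and-map _ (L.allFin n) alone-x (∈-allFin y)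
  ... | x=y∨apart rewrite ⌊⌋-false (x F.≟ y) (y≢x ∘ sym) with sameList m ℓ x y
  ... | false = refl

  firstAlone-alone : ∀ x ℓ f → alone m (ℓ + f) x ≡ true → alone m (firstAlone m x ℓ f) x ≡ true
  firstAlone-alone x ℓ zero    alone-x rewrite +-identityʳ ℓ = alone-x
  firstAlone-alone x ℓ (suc f) alone-x with alone m ℓ x in alone-ℓ
  ... | true  = alone-ℓ
  ... | false = firstAlone-alone x (suc ℓ) f (subst (λ i → alone m i x ≡ true) (+-suc ℓ f) alone-x)

  separated-apart : separated m ≡ true → ∀ x y → y ≢ x → sameList m D x y ≡ false
  separated-apart sep x = alone-apart D x (and-map (alone m D) (L.allFin n) sep (∈-allFin x))

  maxLevel-apart : separated m ≡ true → ∀ x y → y ≢ x → sameList m (maxLevel m x) x y ≡ false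
  maxLevel-apart sep x = alone-apart (maxLevel m x) x
    (firstAlone-alone x 0 D (and-map (alone m D) (L.allFin n) sep (∈-allFin x)))

-- The potential of a search

drop-after : ∀ (P : ℕ → Bool) a d → P a ≡ true → P (a + d) ≡ false →
  ∃[ c ] (a ≤ c × P c ≡ true × P (suc c) ≡ false)
drop-after P a zero    Pa ¬Pa+0 = contradiction (trans (sym Pa) (subst (λ i → P i ≡ false) (+-identityʳ a) ¬Pa+0)) λ ()
drop-after P a (suc d) Pa ¬Pa+d with P (suc a) in Pa+1
... | false = a , ≤-refl , Pa , Pa+1
... | true with drop-after P (suc a) d Pa+1 (subst (λ i → P i ≡ false) (+-suc a d) ¬Pa+d)
...   | c , a<c , Pc , ¬Pc+1 = c , <⇒≤ a<c , Pc , ¬Pc+1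

module Potential {σ D n : ℕ} (key : Fin n → ℕ) (k : ℕ) (s : Fin n) (L : ℕ) where

  ahead : Fin n → Fin n → Bool
  ahead y z = ⌊ key y <? key z ⌋ ∧ ⌊ key z ≤? k ⌋

  ahead-intro : ∀ {y z} → key y < key z → key z ≤ k → ahead y z ≡ true
  ahead-intro {y} {z} y<z z≤k = cong₂ _∧_ (⌊⌋-true (key y <? key z) y<z) (⌊⌋-true (key z ≤? k) z≤k)

  ahead-elim : ∀ {y z} → ahead y z ≡ true → key y < key z × key z ≤ k
  ahead-elim {y} {z} y→z = ⌊⌋-sound (key y <? key z) (∧-conicalˡ _ _ y→z) , ⌊⌋-sound (key z ≤? k) (∧-conicalʳ _ _ y→z)

  ahead-irrefl : ∀ y → ahead y y ≡ false
  ahead-irrefl y = cong (_∧ ⌊ key y ≤? k ⌋) (⌊⌋-false (key y <? key y) (<-irrefl refl))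

  ahead-trans : ∀ {v y} → key v < key y → ∀ z → ahead y z ≡ true → ahead v z ≡ true
  ahead-trans v<y z y→z = ahead-intro (<-trans v<y (proj₁ (ahead-elim y→z))) (proj₂ (ahead-elim y→z))

  count-ahead-injective : Injective _≡_ _≡_ key → ∀ y y′ → ahead s y ≡ true → ahead s y′ ≡ true →
    count (ahead y) ≡ count (ahead y′) → y ≡ y′
  count-ahead-injective inj y y′ s→y s→y′ same with <-cmp (key y) (key y′)
  ... | tri≈ _ y≡y′ _ = inj y≡y′
  ... | tri< y<y′ _ _ = contradiction (sym same) (<⇒≢ (count-< (ahead y′) (ahead y) y′
                          (ahead-trans y<y′) (ahead-intro y<y′ (proj₂ (ahead-elim s→y′))) (ahead-irrefl y′)))
  ... | tri> _ _ y′<y = contradiction same (<⇒≢ (count-< (ahead y) (ahead y′) y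
                          (ahead-trans y′<y) (ahead-intro y′<y (proj₂ (ahead-elim s→y))) (ahead-irrefl y)))

  -- levelWeight m ℓ y indicates that ℓ is the last level on which y shares s's list
  -- and that no node ahead of y is in s's level-(ℓ+1) list; topWeight m y that y
  -- shares s's level-L list but not its level-D list. Both are products of one factor
  -- per node i, depending only on the words of i and s, so that their sums over all
  -- memberships factorise.
  levelFactor : ℕ → Fin n → Fin n → Word σ D → Word σ D → ℕ
  levelFactor ℓ y i x w =
    if ⌊ i F.≟ y ⌋ then 𝟙 (agree ℓ x w ∧ not (agree (suc ℓ) x w))
    else if ahead y i then 𝟙 (not (agree (suc ℓ) x w))
    else 1

  topFactor : Fin n → Fin n → Word σ D → Word σ D → ℕ
  topFactor y i x w = if ⌊ i F.≟ y ⌋ then 𝟙 (agree L x w ∧ not (agree D x w)) else 1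

  levelWeight : Membership σ D n → ℕ → Fin n → ℕ
  levelWeight m ℓ y = ∏[ i < n ] levelFactor ℓ y i (V.lookup m i) (V.lookup m s)

  topWeight : Membership σ D n → Fin n → ℕ
  topWeight m y = ∏[ i < n ] topFactor y i (V.lookup m i) (V.lookup m s)

  weight : Membership σ D n → Fin n → ℕ
  weight m y = ∑[ ℓ < L ] levelWeight m (toℕ ℓ) y + topWeight m y

  potential : Membership σ D n → Fin n → ℕ
  potential m v = ∑[ y < n ] (𝟙 (ahead v y) * weight m y)

  module _ (m : Membership σ D n) where

    inS : ℕ → Fin n → Bool
    inS ℓ z = sameList m ℓ z s

    weight-pos : ∀ {ℓ y} → inS ℓ y ≡ true → inS D y ≡ false →
      (∀ z → ahead y z ≡ true → inS (suc ℓ) z ≡ false) → 1 ≤ weight m y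
    weight-pos {ℓ} {y} y∈ℓ y∉D clear
      with drop-after (λ i → inS i y) ℓ D y∈ℓ (agree-antitoneᶜ _ _ (m≤n+m D ℓ) y∉D)
    ... | c , ℓ≤c , y∈c , y∉c+1 with c <? L
    ...   | yes c<L = begin
      1                                                  ≡⟨ level-c ⟨
      levelWeight m (toℕ (fromℕ< c<L)) y                 ≤⟨ term≤∑ (λ j → levelWeight m (toℕ j) y) (fromℕ< c<L) ⟩
      ∑[ j < L ] levelWeight m (toℕ j) y                 ≤⟨ m≤m+n _ _ ⟩
      weight m y                                         ∎
      where
      factor-c : ∀ i → levelFactor c y i (V.lookup m i) (V.lookup m s) ≡ 1
      factor-c i with i F.≟ y
      ... | yes refl rewrite y∈c | y∉c+1 = refl
      ... | no _ with ahead y i in y→i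
      ...   | true  rewrite agree-antitoneᶜ (V.lookup m i) (V.lookup m s) (s≤s ℓ≤c) (clear i y→i) = refl
      ...   | false = refl
      open ≤-Reasoning
      level-c : levelWeight m (toℕ (fromℕ< c<L)) y ≡ 1
      level-c rewrite Fin.toℕ-fromℕ< c<L = ∏-ones factor-c
    ...   | no c≮L = ≤-trans (≤-reflexive (sym (∏-ones factor-top))) (m≤n+m _ _)
      where
      factor-top : ∀ i → topFactor y i (V.lookup m i) (V.lookup m s) ≡ 1
      factor-top i with i F.≟ y
      ... | yes refl rewrite agree-antitone (V.lookup m y) (V.lookup m s) (≮⇒≥ c≮L) y∈c | y∉D = refl
      ... | no _ = refl

    potential-step : ∀ {v y} → key v < key y → key y ≤ k → weight m y + potential m y ≤ potential m v
    potential-step {v} {y} v<y y≤k =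
      ∑-𝟙-insert (ahead y) (ahead v) (weight m) y (ahead-trans v<y) (ahead-intro v<y y≤k) (ahead-irrefl y)

module Walk {σ D n : ℕ} (key : Fin n → ℕ) (k : ℕ) (s : Fin n) (L : ℕ) (m : Membership σ D n)
            (sep : separated m ≡ true) where

  open Potential {σ} {D} key k s L

  M : Fin n → Word σ D
  M = V.lookup m

  record Invariant (v : Fin n) (ℓ : ℕ) : Set where
    field
      after-s  : key s ≤ key v
      before-k : key v ≤ k
      listed   : inS m ℓ v ≡ true
      clear    : ∀ z → ahead v z ≡ true → inS m (suc ℓ) z ≡ false

  open Invariant

  advance : ∀ {v ℓ y} → Invariant v ℓ → succR key m ℓ v ≡ just y → key y ≤ k → Invariant y ℓ
  advance {v} {ℓ} {y} I next y≤k = record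
    { after-s  = ≤-trans (after-s I) (<⇒≤ v<y)
    ; before-k = y≤k
    ; listed   = agree-trans ℓ (M y) (M v) (M s) (agree-sym ℓ (M v) (M y) v~y) (listed I)
    ; clear    = λ z y→z → clear I z (ahead-trans v<y z y→z)
    }
    where
    v~y : sameList m ℓ v y ≡ true
    v~y = proj₁ (succR-sound key m ℓ v next)
    v<y : key v < key y
    v<y = proj₂ (succR-sound key m ℓ v next)

  PastTarget : Maybe (Fin n) → Set
  PastTarget nothing  = ⊤
  PastTarget (just y) = k < key y

  descend : ∀ {v ℓ r} → Invariant v (suc ℓ) → succR key m (suc ℓ) v ≡ r → PastTarget r → Invariant v ℓ
  descend {v} {ℓ} I next past = record
    { after-s  = after-s I
    ; before-k = before-k I
    ; listed   = agree-antitone (M v) (M s) (n≤1+n ℓ) (listed I)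
    ; clear    = off-list
    }
    where
    off-list : ∀ z → ahead v z ≡ true → inS m (suc ℓ) z ≡ false
    off-list z v→z with inS m (suc ℓ) z in z∈
    ... | false = refl
    ... | true with succR-complete key m (suc ℓ) v z
                      (agree-trans (suc ℓ) (M v) (M s) (M z) (listed I) (agree-sym (suc ℓ) (M z) (M s) z∈))
                      (proj₁ (ahead-elim v→z))
    ...   | y , next′ , y≤z = contradiction (≤-trans y≤z (proj₂ (ahead-elim v→z)))
                                            (<⇒≱ (subst PastTarget (trans (sym next) next′) past))

  searchLoop≤potential : ∀ f v ℓ → Invariant v ℓ → searchLoop key k m f v ℓ ≤ potential m v
  searchLoop≤potential zero    v ℓ I = z≤n
  searchLoop≤potential (suc f) v ℓ I with key v ≟ k
  ... | yes _ = z≤n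
  ... | no v≢k with key v <? k
  ... | no v≮k = contradiction (≤∧≢⇒< (before-k I) v≢k) v≮k
  ... | yes v<k with succR key m ℓ v in next
  ...   | just y with key y ≤? k
  ...     | yes y≤k = ≤-trans (+-mono-≤ (weight-pos m (listed I′) y∉D (clear I′)) (searchLoop≤potential f y ℓ I′))
                              (potential-step m v<y y≤k)
    where
    v<y : key v < key y
    v<y = proj₂ (succR-sound key m ℓ v next)
    I′ : Invariant y ℓ
    I′ = advance I next y≤k
    y∉D : inS m D y ≡ false
    y∉D = separated-apart m sep y s λ s≡y → <-irrefl (cong key s≡y) (≤-<-trans (after-s I) v<y)
  ...     | no y≰k with ℓ
  ...       | zero   = z≤n
  ...       | suc ℓ′ = searchLoop≤potential f v ℓ′ (descend I next (≰⇒> y≰k))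
  searchLoop≤potential (suc f) v ℓ I | no v≢k | yes v<k | nothing with ℓ
  ...       | zero   = z≤n
  ...       | suc ℓ′ = searchLoop≤potential f v ℓ′ (descend I next tt)

  searchMessages≤1+potential : key s ≤ k → searchMessages key k m s ≤ suc (potential m s)
  searchMessages≤1+potential s≤k = s≤s (searchLoop≤potential (n * (D + 2) + D + 2) s (maxLevel m s) start)
    where
    start : Invariant s (maxLevel m s)
    start = record
      { after-s  = ≤-refl
      ; before-k = s≤k
      ; listed   = agree-refl _ (M s)
      ; clear    = λ z s→z → agree-antitoneᶜ (M z) (M s) (n≤1+n _) (agree-symᶜ _ (M s) (M z)
                     (maxLevel-apart m sep s z λ { refl → contradiction (trans (sym (ahead-irrefl s)) s→z) λ () }))
      }

-- Expected potential

m∸n≤1+[m∸[1+n]] : ∀ d ℓ → d ∸ ℓ ≤ suc (d ∸ suc ℓ)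
m∸n≤1+[m∸[1+n]] zero    zero    = z≤n
m∸n≤1+[m∸[1+n]] zero    (suc ℓ) = z≤n
m∸n≤1+[m∸[1+n]] (suc d) zero    = ≤-refl
m∸n≤1+[m∸[1+n]] (suc d) (suc ℓ) = m∸n≤1+[m∸[1+n]] d ℓ

module Expectation {σ D n : ℕ} .{{_ : NonZero σ}} (key : Fin n → ℕ) (k : ℕ) (s : Fin n) (L : ℕ) where

  open Potential {σ} {D} key k s L

  T : ℕ
  T = σ ^ D

  Δ : ℕ → ℕ
  Δ ℓ = σ ^ (D ∸ suc ℓ)

  Δ≤T : ∀ ℓ → Δ ℓ ≤ T
  Δ≤T ℓ = ^-monoʳ-≤ σ (m∸n≤m D (suc ℓ))

  -- 𝔼 f is σ ^ (n * D) times the expectation of f under uniformly random membership words.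
  𝔼 : (Membership σ D n → ℕ) → ℕ
  𝔼 f = ∑[ m ∈ allMemberships σ D n ] f m

  levelBound : ℕ → Fin n → Fin n → ℕ
  levelBound ℓ y i = if ⌊ i F.≟ y ⌋ then (σ ∸ 1) * Δ ℓ else (if ahead y i then T ∸ Δ ℓ else T)

  count-level-band : ∀ ℓ w → ∑[ x ∈ words σ D ] 𝟙 (agree ℓ x w ∧ not (agree (suc ℓ) x w)) ≤ (σ ∸ 1) * Δ ℓ
  count-level-band ℓ w = begin
    ∑[ x ∈ words σ D ] 𝟙 (agree ℓ x w ∧ not (agree (suc ℓ) x w))   ≡⟨ count-band σ D w (n≤1+n ℓ) ⟩
    σ ^ (D ∸ ℓ) ∸ Δ ℓ                                               ≤⟨ ∸-monoˡ-≤ (Δ ℓ) (^-monoʳ-≤ σ (m∸n≤1+[m∸[1+n]] D ℓ)) ⟩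
    σ * Δ ℓ ∸ Δ ℓ                                                   ≡⟨ cong (σ * Δ ℓ ∸_) (*-identityˡ (Δ ℓ)) ⟨
    σ * Δ ℓ ∸ 1 * Δ ℓ                                               ≡⟨ *-distribʳ-∸ (Δ ℓ) σ 1 ⟨
    (σ ∸ 1) * Δ ℓ                                                   ∎
    where open ≤-Reasoning

  𝔼-levelWeight : ∀ ℓ y → 𝔼 (λ m → levelWeight m ℓ y) ≤ ∏[ i < n ] levelBound ℓ y i
  𝔼-levelWeight ℓ y = ∑-allVecs-∏-pinned-≤ n (words σ D) s (levelFactor ℓ y) (levelBound ℓ y) bound bound-s
    where
    bound : ∀ i → i ≢ s → ∀ w → ∑[ x ∈ words σ D ] levelFactor ℓ y i x w ≤ levelBound ℓ y i
    bound i _ w with i F.≟ y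
    ... | yes _ = count-level-band ℓ w
    ... | no _ with ahead y i
    ...   | true  = ≤-reflexive (count-band σ D w z≤n)
    ...   | false = ≤-reflexive (count-words σ D)
    bound-s : ∑[ x ∈ words σ D ] levelFactor ℓ y s x x ≤ levelBound ℓ y s
    bound-s with s F.≟ y
    ... | yes _ = ∑∈-zero-≤ (words σ D) _ λ x →
        trans (cong (λ b → 𝟙 (agree ℓ x x ∧ not b)) (agree-refl (suc ℓ) x)) (cong 𝟙 (∧-zeroʳ (agree ℓ x x)))
    ... | no _ with ahead y s
    ...   | true  = ∑∈-zero-≤ (words σ D) _ λ x → cong (𝟙 ∘ not) (agree-refl (suc ℓ) x)
    ...   | false = ≤-reflexive (count-words σ D)

  avoid : ℕ → ℕ → ℕ
  avoid ℓ j = (T ∸ Δ ℓ) ^ j * T ^ (n ∸ j)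

  ∏-levelBound : ∀ ℓ y → T * ∏[ i < n ] levelBound ℓ y i ≡ (σ ∸ 1) * Δ ℓ * avoid ℓ (count (ahead y))
  ∏-levelBound ℓ y = begin
    T * ∏[ i < n ] levelBound ℓ y i
      ≡⟨ *-comm T _ ⟩
    ∏[ i < n ] levelBound ℓ y i * T
      ≡⟨ cong (λ b → ∏[ i < n ] levelBound ℓ y i * (if b then T ∸ Δ ℓ else T)) (ahead-irrefl y) ⟨
    ∏[ i < n ] levelBound ℓ y i * (if ahead y y then T ∸ Δ ℓ else T)
      ≡⟨ ∏-update y (λ _ → (σ ∸ 1) * Δ ℓ) (λ i → if ahead y i then T ∸ Δ ℓ else T) ⟩
    (σ ∸ 1) * Δ ℓ * ∏[ i < n ] (if ahead y i then T ∸ Δ ℓ else T)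
      ≡⟨ cong ((σ ∸ 1) * Δ ℓ *_) (∏-if (ahead y) (T ∸ Δ ℓ) T) ⟩
    (σ ∸ 1) * Δ ℓ * avoid ℓ (count (ahead y)) ∎
    where open ≡-Reasoning

  geometric-bound : ∀ ℓ → Δ ℓ * ∑[ j < n ] avoid ℓ (toℕ j) ≤ T ^ suc n
  geometric-bound ℓ = subst (λ t → Δ ℓ * ∑[ j < n ] ((T ∸ Δ ℓ) ^ toℕ j * t ^ (n ∸ toℕ j)) ≤ t ^ suc n)
    (m∸n+n≡m (Δ≤T ℓ)) (≤-trans (m≤m+n _ _) (≤-reflexive (geometric n (T ∸ Δ ℓ) (Δ ℓ))))

  𝔼-level : Injective _≡_ _≡_ key → ∀ ℓ → ∑[ y < n ] (𝟙 (ahead s y) * 𝔼 (λ m → levelWeight m ℓ y)) ≤ (σ ∸ 1) * T ^ n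
  𝔼-level inj ℓ = *-cancelˡ-≤ T (begin
    T * ∑[ y < n ] (𝟙 (ahead s y) * 𝔼 (λ m → levelWeight m ℓ y))
      ≡⟨ *-distribˡ-sum {n} T _ ⟩
    ∑[ y < n ] (T * (𝟙 (ahead s y) * 𝔼 (λ m → levelWeight m ℓ y)))
      ≤⟨ ∑-mono-≤ {n} per-node ⟩
    ∑[ y < n ] (𝟙 (ahead s y) * (c * avoid ℓ (count (ahead y))))
      ≡⟨ sum-cong-≗ {n} (λ y → *-exchange (𝟙 (ahead s y)) c _) ⟩
    ∑[ y < n ] (c * (𝟙 (ahead s y) * avoid ℓ (count (ahead y))))
      ≡⟨ *-distribˡ-sum {n} c _ ⟨
    c * ∑[ y < n ] (𝟙 (ahead s y) * avoid ℓ (count (ahead y)))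
      ≤⟨ *-monoʳ-≤ c (∑-injective-≤ (ahead s) (count ∘ ahead) (avoid ℓ)
                       (λ y _ → count-<n (ahead y) y (ahead-irrefl y)) (count-ahead-injective inj)) ⟩
    c * ∑[ j < n ] avoid ℓ (toℕ j)
      ≡⟨ *-assoc (σ ∸ 1) (Δ ℓ) _ ⟩
    (σ ∸ 1) * (Δ ℓ * ∑[ j < n ] avoid ℓ (toℕ j))
      ≤⟨ *-monoʳ-≤ (σ ∸ 1) (geometric-bound ℓ) ⟩
    (σ ∸ 1) * (T * T ^ n)
      ≡⟨ *-exchange (σ ∸ 1) T _ ⟩
    T * ((σ ∸ 1) * T ^ n) ∎)
    where
    open ≤-Reasoning
    instance
      T≢0 : NonZero T
      T≢0 = m^n≢0 σ D
    c : ℕ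
    c = (σ ∸ 1) * Δ ℓ
    per-node : ∀ y → T * (𝟙 (ahead s y) * 𝔼 (λ m → levelWeight m ℓ y)) ≤ 𝟙 (ahead s y) * (c * avoid ℓ (count (ahead y)))
    per-node y = begin
      T * (𝟙 (ahead s y) * 𝔼 (λ m → levelWeight m ℓ y))   ≡⟨ *-exchange T (𝟙 (ahead s y)) _ ⟩
      𝟙 (ahead s y) * (T * 𝔼 (λ m → levelWeight m ℓ y))   ≤⟨ *-monoʳ-≤ (𝟙 (ahead s y)) (*-monoʳ-≤ T (𝔼-levelWeight ℓ y)) ⟩
      𝟙 (ahead s y) * (T * ∏[ i < n ] levelBound ℓ y i)   ≡⟨ cong (𝟙 (ahead s y) *_) (∏-levelBound ℓ y) ⟩
      𝟙 (ahead s y) * (c * avoid ℓ (count (ahead y)))         ∎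

  topBound : Fin n → Fin n → ℕ
  topBound y i = if ⌊ i F.≟ y ⌋ then σ ^ (D ∸ L) ∸ 1 else T

  count-top-band : ∀ w → ∑[ x ∈ words σ D ] 𝟙 (agree L x w ∧ not (agree D x w)) ≤ σ ^ (D ∸ L) ∸ 1
  count-top-band w with L ≤? D
  ... | yes L≤D = ≤-reflexive (trans (count-band σ D w L≤D) (cong (λ e → σ ^ (D ∸ L) ∸ σ ^ e) (n∸n≡0 D)))
  ... | no  L≰D = ∑∈-zero-≤ (words σ D) _ empty
    where
    empty : ∀ x → 𝟙 (agree L x w ∧ not (agree D x w)) ≡ 0
    empty x with agree L x w in x~w
    ... | false = refl
    ... | true rewrite agree-antitone x w (<⇒≤ (≰⇒> L≰D)) x~w = refl

  𝔼-topWeight : ∀ y → 𝔼 (λ m → topWeight m y) ≤ ∏[ i < n ] topBound y i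
  𝔼-topWeight y = ∑-allVecs-∏-pinned-≤ n (words σ D) s (topFactor y) (topBound y) bound bound-s
    where
    bound : ∀ i → i ≢ s → ∀ w → ∑[ x ∈ words σ D ] topFactor y i x w ≤ topBound y i
    bound i _ w with i F.≟ y
    ... | yes _ = count-top-band w
    ... | no _  = ≤-reflexive (count-words σ D)
    bound-s : ∑[ x ∈ words σ D ] topFactor y s x x ≤ topBound y s
    bound-s with s F.≟ y
    ... | yes _ = ∑∈-zero-≤ (words σ D) _ λ x →
        trans (cong (λ b → 𝟙 (agree L x x ∧ not b)) (agree-refl D x)) (cong 𝟙 (∧-zeroʳ (agree L x x)))
    ... | no _  = ≤-reflexive (count-words σ D)

  ∏-topBound : ∀ y → T * ∏[ i < n ] topBound y i ≡ (σ ^ (D ∸ L) ∸ 1) * T ^ n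
  ∏-topBound y = trans (*-comm T _)
    (trans (∏-update y (λ _ → σ ^ (D ∸ L) ∸ 1) (λ _ → T)) (cong ((σ ^ (D ∸ L) ∸ 1) *_) (∏-const n T)))

  top-room : (σ ^ (D ∸ L) ∸ 1) * σ ^ L ≤ T
  top-room with L ≤? D
  ... | no  L≰D rewrite m≤n⇒m∸n≡0 (<⇒≤ (≰⇒> L≰D)) = z≤n
  ... | yes L≤D = begin
    (σ ^ (D ∸ L) ∸ 1) * σ ^ L   ≤⟨ *-monoˡ-≤ (σ ^ L) (m∸n≤m (σ ^ (D ∸ L)) 1) ⟩
    σ ^ (D ∸ L) * σ ^ L         ≡⟨ ^-distribˡ-+-* σ (D ∸ L) L ⟨
    σ ^ (D ∸ L + L)             ≡⟨ cong (σ ^_) (m∸n+n≡m L≤D) ⟩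
    T                           ∎
    where open ≤-Reasoning

  𝔼-top : n ≤ σ ^ L → ∑[ y < n ] (𝟙 (ahead s y) * 𝔼 (λ m → topWeight m y)) ≤ T ^ n
  𝔼-top n≤σ^L = *-cancelˡ-≤ T (begin
    T * ∑[ y < n ] (𝟙 (ahead s y) * 𝔼 (λ m → topWeight m y))    ≡⟨ *-distribˡ-sum {n} T _ ⟩
    ∑[ y < n ] (T * (𝟙 (ahead s y) * 𝔼 (λ m → topWeight m y)))  ≤⟨ ∑-mono-≤ {n} per-node ⟩
    ∑[ y < n ] (t * T ^ n)                                       ≡⟨ ∑-const n _ ⟩
    n * (t * T ^ n)                                              ≤⟨ *-monoˡ-≤ _ n≤σ^L ⟩
    σ ^ L * (t * T ^ n)                                          ≡⟨ *-assoc (σ ^ L) t _ ⟨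
    σ ^ L * t * T ^ n                                            ≡⟨ cong (_* T ^ n) (*-comm (σ ^ L) t) ⟩
    t * σ ^ L * T ^ n                                            ≤⟨ *-monoˡ-≤ (T ^ n) top-room ⟩
    T * T ^ n                                                    ∎)
    where
    open ≤-Reasoning
    instance
      T≢0 : NonZero T
      T≢0 = m^n≢0 σ D
    t : ℕ
    t = σ ^ (D ∸ L) ∸ 1
    per-node : ∀ y → T * (𝟙 (ahead s y) * 𝔼 (λ m → topWeight m y)) ≤ t * T ^ n
    per-node y = begin
      T * (𝟙 (ahead s y) * 𝔼 (λ m → topWeight m y))   ≡⟨ *-exchange T (𝟙 (ahead s y)) _ ⟩
      𝟙 (ahead s y) * (T * 𝔼 (λ m → topWeight m y))   ≤⟨ *-mono-≤ (𝟙≤1 (ahead s y)) (*-monoʳ-≤ T (𝔼-topWeight y)) ⟩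
      1 * (T * ∏[ i < n ] topBound y i)               ≡⟨ *-identityˡ _ ⟩
      T * ∏[ i < n ] topBound y i                     ≡⟨ ∏-topBound y ⟩
      t * T ^ n                                       ∎

  𝔼-potential : Injective _≡_ _≡_ key → n ≤ σ ^ L → 𝔼 (λ m → potential m s) ≤ L * ((σ ∸ 1) * T ^ n) + T ^ n
  𝔼-potential inj n≤σ^L = begin
    𝔼 (λ m → potential m s)
      ≡⟨ ∑∈-∑-comm {n = n} ms (λ m y → 𝟙 (ahead s y) * weight m y) ⟩
    ∑[ y < n ] ∑[ m ∈ ms ] (𝟙 (ahead s y) * weight m y)
      ≡⟨ sum-cong-≗ {n} (λ y → trans (sym (*-distribˡ-∑∈ (𝟙 (ahead s y)) ms (λ m → weight m y)))
                                     (cong (𝟙 (ahead s y) *_) (𝔼-weight y))) ⟩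
    ∑[ y < n ] (𝟙 (ahead s y) * (∑[ ℓ < L ] level ℓ y + top y))
      ≡⟨ sum-cong-≗ {n} (λ y → *-distribˡ-+ (𝟙 (ahead s y)) _ (top y)) ⟩
    ∑[ y < n ] (𝟙 (ahead s y) * ∑[ ℓ < L ] level ℓ y + 𝟙 (ahead s y) * top y)
      ≡⟨ ∑-distrib-+ (λ y → 𝟙 (ahead s y) * ∑[ ℓ < L ] level ℓ y) (λ y → 𝟙 (ahead s y) * top y) ⟩
    ∑[ y < n ] (𝟙 (ahead s y) * ∑[ ℓ < L ] level ℓ y) + ∑[ y < n ] (𝟙 (ahead s y) * top y)
      ≡⟨ cong (_+ ∑[ y < n ] (𝟙 (ahead s y) * top y)) (trans (sum-cong-≗ {n} λ y → *-distribˡ-sum {L} (𝟙 (ahead s y)) (λ ℓ → level ℓ y))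
                            (∑-comm (λ y ℓ → 𝟙 (ahead s y) * level ℓ y))) ⟩
    ∑[ ℓ < L ] ∑[ y < n ] (𝟙 (ahead s y) * level ℓ y) + ∑[ y < n ] (𝟙 (ahead s y) * top y)
      ≤⟨ +-mono-≤ (∑-mono-≤ {L} (λ ℓ → 𝔼-level inj (toℕ ℓ))) (𝔼-top n≤σ^L) ⟩
    ∑[ ℓ < L ] ((σ ∸ 1) * T ^ n) + T ^ n
      ≡⟨ cong (_+ T ^ n) (∑-const L _) ⟩
    L * ((σ ∸ 1) * T ^ n) + T ^ n ∎
    where
    open ≤-Reasoning
    ms : List (Membership σ D n)
    ms = allMemberships σ D n
    level : Fin L → Fin n → ℕ
    level ℓ y = 𝔼 (λ m → levelWeight m (toℕ ℓ) y)
    top : Fin n → ℕ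
    top y = 𝔼 (λ m → topWeight m y)
    𝔼-weight : ∀ y → 𝔼 (λ m → weight m y) ≡ ∑[ ℓ < L ] level ℓ y + top y
    𝔼-weight y = trans (∑∈-distrib-+ ms _ _) (cong (_+ top y) (∑∈-∑-comm {n = L} ms (λ m ℓ → levelWeight m (toℕ ℓ) y)))

-- The logarithmic bound

module _ {σ D n : ℕ} .{{_ : NonZero σ}} (L : ℕ) (n≤σ^L : n ≤ σ ^ L) where

  private
    P : ℕ
    P = (σ ^ D) ^ n

  truncMessages-≤-rightward : ∀ (key : Fin n → ℕ) → Injective _≡_ _≡_ key → ∀ k s → key s ≤ k →
    truncMessages σ D n key k s ≤ P + (L * ((σ ∸ 1) * P) + P)
  truncMessages-≤-rightward key inj k s s≤k = begin
    truncMessages σ D n key k s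
      ≤⟨ ∑∈-mono-≤ ms per-membership ⟩
    ∑[ m ∈ ms ] (1 + potential m s)
      ≡⟨ ∑∈-distrib-+ ms (λ _ → 1) (λ m → potential m s) ⟩
    ∑[ m ∈ ms ] 1 + 𝔼 (λ m → potential m s)
      ≤⟨ +-mono-≤ (≤-reflexive (trans (∑-allVecs-1 n (words σ D)) (cong (_^ n) (count-words σ D))))
                  (𝔼-potential inj n≤σ^L) ⟩
    P + (L * ((σ ∸ 1) * P) + P) ∎
    where
    open ≤-Reasoning
    open Potential {σ} {D} key k s L
    open Expectation {σ} {D} key k s L using (𝔼; 𝔼-potential)
    ms : List (Membership σ D n)
    ms = allMemberships σ D n
    per-membership : ∀ m → (if separated m then searchMessages key k m s else 0) ≤ 1 + potential m s
    per-membership m with separated m in sep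
    ... | true  = Walk.searchMessages≤1+potential key k s L m sep s≤k
    ... | false = z≤n

  truncMessages-≤ : ∀ (key : Fin n → ℕ) → Injective _≡_ _≡_ key → ∀ k s →
    truncMessages σ D n key k s ≤ P + (L * ((σ ∸ 1) * P) + P)
  truncMessages-≤ key inj k s with key s ≤? k
  ... | yes s≤k = truncMessages-≤-rightward key inj k s s≤k
  ... | no  s≰k = begin
    truncMessages σ D n key k s     ≡⟨ ∑∈-cong (allMemberships σ D n) (λ m → cong (if separated m then_else 0)
                                          (searchMessages-mirror m s)) ⟨
    truncMessages σ D n key′ k′ s   ≤⟨ truncMessages-≤-rightward key′ (key′-injective inj) k′ s
                                          (∸-monoʳ-≤ K (<⇒≤ (≰⇒> s≰k))) ⟩
    P + (L * ((σ ∸ 1) * P) + P)     ∎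
    where
    open ≤-Reasoning
    K : ℕ
    K = k + ∑[ v < n ] key v
    open Mirror key k K (λ v → ≤-trans (term≤∑ key v) (m≤n+m _ k)) (m≤m+n k _)

n<2^[1+⌊log₂n⌋] : ∀ n → n < 2 ^ suc ⌊log₂ n ⌋
n<2^[1+⌊log₂n⌋] n with 2 ^ suc ⌊log₂ n ⌋ ≤? n
... | no  2^≰n = ≰⇒> 2^≰n
... | yes 2^≤n = contradiction (subst (_≤ ⌊log₂ n ⌋) (⌊log₂[2^n]⌋≡n (suc ⌊log₂ n ⌋)) (⌊log₂⌋-mono-≤ 2^≤n)) (n≮n _)

p+[[2+t]*[u*p]+p]≤2*[1+u]*[1+t]*p : ∀ t u p → p + (suc (suc t) * (u * p) + p) ≤ 2 * suc u * suc t * p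
p+[[2+t]*[u*p]+p]≤2*[1+u]*[1+t]*p t u p = ≤-trans (m≤m+n _ ((2 * t + t * u) * p)) (≤-reflexive
  (solve 3 (λ t u p → p :+ ((con 2 :+ t) :* (u :* p) :+ p) :+ (con 2 :* t :+ t :* u) :* p
                      := con 2 :* (con 1 :+ u) :* (con 1 :+ t) :* p) refl t u p))

truncMessages-≤-log : ∀ σ → 2 ≤ σ → ∀ n → 2 ≤ n → (key : Fin n → ℕ) → Injective _≡_ _≡_ key → ∀ k s D →
  truncMessages σ D n key k s ≤ 2 * σ * ⌊log₂ n ⌋ * σ ^ (n * D)
truncMessages-≤-log 1 (s≤s ())
truncMessages-≤-log (suc (suc σ′)) _ n 2≤n key inj k s D with ⌊log₂ n ⌋ in lg | ⌊log₂⌋-mono-≤ 2≤n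
... | zero  | ()
... | suc t | _ = begin
  truncMessages σ D n key k s                    ≤⟨ truncMessages-≤ (suc (suc t)) n≤σ^L key inj k s ⟩
  P + (suc (suc t) * (suc σ′ * P) + P)            ≤⟨ p+[[2+t]*[u*p]+p]≤2*[1+u]*[1+t]*p t (suc σ′) P ⟩
  2 * σ * suc t * P                               ≡⟨ cong (2 * σ * suc t *_) (trans (^-*-assoc σ D n) (cong (σ ^_) (*-comm D n))) ⟩
  2 * σ * suc t * σ ^ (n * D)                     ∎
  where
  open ≤-Reasoning
  σ : ℕ
  σ = suc (suc σ′)
  P : ℕ
  P = (σ ^ D) ^ n
  n≤σ^L : n ≤ σ ^ suc (suc t)
  n≤σ^L = ≤-trans (<⇒≤ (subst (λ e → n < 2 ^ suc e) lg (n<2^[1+⌊log₂n⌋] n))) (^-monoˡ-≤ (suc (suc t)) (s≤s (s≤s z≤n)))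

lemma2 : ∀ (σ : ℕ) → 2 ≤ σ →
    ∃[ C ] ∃[ N ] ∀ (n : ℕ) → N ≤ n →
      ∀ (key : Fin n → ℕ) → Injective _≡_ _≡_ key →
      ∀ (k : ℕ) (s : Fin n) (D : ℕ) →
        (truncMessages σ D n key k s ≤ C * ⌊log₂ n ⌋ * σ ^ (n * D))
        × (truncTime σ D n key k s ≤ C * ⌊log₂ n ⌋ * σ ^ (n * D))
lemma2 σ 2≤σ = 2 * σ , 2 , λ n 2≤n key inj k s D →
  let bound = truncMessages-≤-log σ 2≤σ n 2≤n key inj k s D in bound , bound
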